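{- Let $\mathcal L_1$ and $\mathcal L_2$ be sound matrix logics with equivalence, similar signatures and complementary constructors with identities, and let $\mathcal B_1$ and $\mathcal B_2$ be bases for the admissible rules of $\mathcal L_1$ and $\mathcal L_2$, respectively. Then for all formulas $\alpha_1,\dots,\alpha_m,\beta\in L_{12}(\Xi)$: if $\alpha_1,\dots,\alpha_m\vdash_{12}^{\overline{\mathcal B_1}\cup\overline{\mathcal B_2}}\beta$, then $\alpha_1\dots\alpha_m/\beta$ is an admissible rule of the meet-combination $\mathcal L_1\mathcal L_2$.
   Context: A matrix logic is a triple $\mathcal L=(\Sigma,\Delta,\mathcal M)$: $\Sigma=\{\Sigma_n\}_{n\in\mathbb N}$ with $\Sigma_n$ a set of $n$-ary constructors; $L(\Xi)$ is the set of formulas over $\Sigma$ and schema variables $\Xi=\{\xi_k:k\in\mathbb N\}$; $\Delta$ is a set of finitary rules (rules with no premises are axioms); $\mathcal M$ is a nonempty class of matrices $(\mathfrak A,D)$ ($\mathfrak A$ a $\Sigma$-algebra, $D$ a nonempty subset of its carrier); $\Gamma\models\varphi$ means that in every matrix of $\mathcal M$ under every assignment, if all of $\Gamma$ denote elements of $D$ so does $\varphi$. For a set of rules $\mathcal R$, $\Gamma\vdash^{\mathcal R}\varphi$ means there is a sequence $\varphi_1,\dots,\varphi_n=\varphi$ each member of which is in $\Gamma$ or is the conclusion of a substitution instance of a rule of $\mathcal R\cup\Delta$ whose premises occur earlier; $\vdash$ is $\vdash^{\emptyset}$, and $\vdash\varphi$ means $\emptyset\vdash\varphi$. Sound: $\Gamma\vdash\varphi$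 implies $\Gamma\models\varphi$. Standing assumptions: $\top,\bot\in\Sigma_0$, $\vdash\top$, $\bot\vdash\varphi$ for all $\varphi$, $\top$ always denotes a distinguished value and $\bot$ never does; for each $n\ge1$ there is $\top^n\in\Sigma_n$ with $\top^n(\varphi_1,\dots,\varphi_n)$ equivalent to $\top$ (in particular a theorem). Substitutions $\sigma:\Xi\to L(\Xi)$ are extended to formulas. A rule $\alpha_1\dots\alpha_m/\beta$ is admissible in $\mathcal L$ if for every substitution $\sigma$, $\vdash\sigma(\alpha_i)$ for all $i$ implies $\vdash\sigma(\beta)$. A basis for the admissible rules of $\mathcal L$ is a set $\mathcal B$ of admissible rules of $\mathcal L$ such that $\alpha_1,\dots,\alpha_m\vdash^{\mathcal B}\beta$ for every admissible rule $\alpha_1\dots\alpha_m/\beta$ of $\mathcal L$. Meet-combination $\mathcal L_1\mathcal L_2$ of $\mathcal L_1=(\Sigma_1,\Delta_1,\mathcal M_1)$ and $\mathcal L_2=(\Sigma_2,\Delta_2,\mathcal M_2)$: $n$-ary constructors are the pairs $(c_1c_2)$, $c_k\in\Sigma_{kn}$; formulas $L_{12}(\Xi)$; $c_1\in\Sigma_{1n}$ is identified with $(c_1\top^n_2)$ and $c_2$ with $(\top^n_1c_2)$ ($\top^0=\top$), so $L_k(\Xi)\subseteq L_{12}(\Xi)$. The projection $|\varphi|_k$ replaces each combined constructor by its $k$-th component. Tagging of a rule $r=\alpha_1\dots\alpha_m/\beta$ of $\mathcal L_k$: $\overline r=\{r\}$ if $\beta$ is not a schema variable; otherwise $\overline r$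 consists, for each $n$ and $c\in\Sigma_{kn}$, of the rule obtained by substituting $\beta$ by $c(\xi_{j+1},\dots,\xi_{j+n})$ ($j$ the maximum index of schema variables in $r$) and fixing the other variables; for a set of rules $\mathcal R$, $\overline{\mathcal R}=\bigcup_{r\in\mathcal R}\overline r$. The calculus $\Delta_{12}$ of $\mathcal L_1\mathcal L_2$ consists of the rules in $\overline{\Delta_1}\cup\overline{\Delta_2}$, the lifting rules $|\varphi|_1\ |\varphi|_2/\varphi$, co-lifting rules $\varphi/|\varphi|_k$ ($k=1,2$), for all $\varphi\in L_{12}(\Xi)$, and $\bot_1/\bot_2$, $\bot_2/\bot_1$; its semantics is the class of product matrices $(\mathfrak A_1\times\mathfrak A_2,D_1\times D_2)$ with componentwise operations. $\vdash_{12}^{\mathcal R}$ is derivability in $\mathcal L_1\mathcal L_2$ with the extra rules $\mathcal R$. $\mathcal L$ has equivalence if there is a binary constructor $\leftrightarrow$ with: $\vdash\varphi\leftrightarrow\varphi$; symmetry and transitivity of $\vdash\cdot\leftrightarrow\cdot$; $\vdash\varphi_i\leftrightarrow\varphi_i'$ ($i=1..n$) implies $\vdash c(\varphi_1,\dots,\varphi_n)\leftrightarrow c(\varphi_1',\dots,\varphi_n')$ for every $n$-ary $c$; and $\vdash\varphi$, $\vdash\varphi\leftrightarrow\varphi'$ imply $\vdash\varphi'$. The decomposition tree $t(\varphi)$ is the rooted tree of subformula occurrences of $\varphi$, with edges from $c(\varphi_1,\dots,\varphi_m)$ to each $\varphi_i$. A tree embedding is a pair of injective maps on vertices and edges preserving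 sources and targets of edges and outdegrees of sources; $t(\varphi_1)\approx t(\varphi_2)$ means each tree embeds into the other. An $n$-ary constructor $c$ ($n\ge2$) has identities for position $k$ if there are $o_i\in\Sigma_0$ ($i\ne k$) with $\vdash c(o_1,\dots,o_{k-1},\varphi,o_{k+1},\dots,o_n)\leftrightarrow\varphi$ for all $\varphi$; it has pairwise formula completion for position $j\ne k$ if for every $\psi$ there is $\delta$ with $\vdash o_j\leftrightarrow\delta$ and $t(\delta)\approx t(\psi)$. $\mathcal L,\mathcal L'$ have complementary constructors with identities if $\mathcal L$ has an $n$-ary $c$ with identities for position $k$ and pairwise formula completion for position $k'$, $\mathcal L'$ has an $n$-ary $c'$ with identities for position $k'$ and pairwise formula completion for position $k$, and $k\ne k'$. Similar signatures: $\Sigma_i=\emptyset$ iff $\Sigma'_i=\emptyset$ for all $i$. -}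

module Defs where

open import Data.Nat using (ℕ; zero; suc; _+_; _⊔_; _≤_; _≡ᵇ_)
open import Data.Fin using (Fin; toℕ) renaming (_≟_ to _≟F_)
open import Data.Vec using (Vec; []; _∷_; lookup; tabulate)
open import Data.List using (List; []; _∷_; map; foldr)
open import Data.List.Membership.Propositional using (_∈_)
open import Data.Product using (Σ; Σ-syntax; ∃; ∃-syntax; _×_; _,_; proj₁; proj₂)
open import Data.Sum using (_⊎_)
open import Data.Empty using (⊥)
open import Data.Bool using (if_then_else_)
open import Relation.Nullary using (¬_; does)
open import Relation.Binary.PropositionalEquality using (_≡_; _≢_)
open import Function.Definitions using (Injective)

Sig : Set₁
Sig = ℕ → Set

-- formulas L(Ξ); schema variable ξ_k is  var k
data Fm (S : Sig) : Set where
  var : ℕ → Fm S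
  con : ∀ {n} → S n → Vec (Fm S) n → Fm S

module _ {S : Sig} where

  mutual
    sub : (ℕ → Fm S) → Fm S → Fm S
    sub σ (var i) = σ i
    sub σ (con c as) = con c (subs σ as)

    subs : ∀ {n} → (ℕ → Fm S) → Vec (Fm S) n → Vec (Fm S) n
    subs σ [] = []
    subs σ (a ∷ as) = sub σ a ∷ subs σ as

  mutual
    maxVar : Fm S → ℕ
    maxVar (var i) = i
    maxVar (con c as) = maxVars as

    maxVars : ∀ {n} → Vec (Fm S) n → ℕ
    maxVars [] = 0
    maxVars (a ∷ as) = maxVar a ⊔ maxVars as

module _ {S S' : Sig} (f : ∀ {n} → S n → S' n) where
  mutual
    rename : Fm S → Fm S'
    rename (var i) = var i
    rename (con c as) = con (f c) (renames as)

    renames : ∀ {n} → Vec (Fm S) n → Vec (Fm S') n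
    renames [] = []
    renames (a ∷ as) = rename a ∷ renames as

-- finitary rule  prem / concl  (axiom if prem = [])
record Rule (S : Sig) : Set where
  constructor _/_
  field
    prem  : List (Fm S)
    concl : Fm S
open Rule public

RuleSet : Sig → Set₁
RuleSet S = Rule S → Set

FmSet : Sig → Set₁
FmSet S = Fm S → Set

_∪R_ : ∀ {S} → RuleSet S → RuleSet S → RuleSet S
(R ∪R R') r = R r ⊎ R' r

∅F : ∀ {S} → FmSet S
∅F _ = ⊥

∅R : ∀ {S} → RuleSet S
∅R _ = ⊥

listSet : ∀ {S} → List (Fm S) → FmSet S
listSet xs φ = φ ∈ xs

singleton : ∀ {S} → Fm S → FmSet S
singleton ψ φ = φ ≡ ψ

substRule : ∀ {S} → (ℕ → Fm S) → Rule S → Rule S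
substRule σ r = map (sub σ) (prem r) / sub σ (concl r)

-- A derivation sequence φ_1, ..., φ_n from Γ using the rules R, stored in
-- reverse order (the head of the list is the most recent member): each member
-- is in Γ or is the conclusion of a substitution instance of a rule of R whose
-- premises occur earlier in the sequence.
data Deriv {S : Sig} (R : RuleSet S) (Γ : FmSet S) : List (Fm S) → Set where
  empty : Deriv R Γ []
  hyp   : ∀ {ψs φ} → Deriv R Γ ψs → Γ φ → Deriv R Γ (φ ∷ ψs)
  rule  : ∀ {ψs} (r : Rule S) → R r → (σ : ℕ → Fm S) →
          (∀ {p} → p ∈ prem r → sub σ p ∈ ψs) →
          Deriv R Γ ψs → Deriv R Γ (sub σ (concl r) ∷ ψs)

Derivable : ∀ {S} → RuleSet S → FmSet S → Fm S → Set
Derivable R Γ φ = ∃[ ψs ] Deriv R Γ (φ ∷ ψs)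

record Matrix (S : Sig) : Set₁ where
  field
    Carrier    : Set
    op         : ∀ {n} → S n → Vec Carrier n → Carrier
    D          : Carrier → Set
    D-nonempty : Σ Carrier D

module _ {S : Sig} (M : Matrix S) where
  open Matrix M
  mutual
    eval : (ℕ → Carrier) → Fm S → Carrier
    eval ρ (var i) = ρ i
    eval ρ (con c as) = op c (evals ρ as)

    evals : ∀ {n} → (ℕ → Carrier) → Vec (Fm S) n → Vec Carrier n
    evals ρ [] = []
    evals ρ (a ∷ as) = eval ρ a ∷ evals ρ as

record MatrixLogic : Set₂ where
  field
    sig        : Sig
    Δ          : RuleSet sig
    𝓜          : Matrix sig → Set₁
    𝓜-nonempty : Σ (Matrix sig) 𝓜
    ⊤c         : sig 0
    ⊥c         : sig 0
    ⊤s         : ∀ n → sig (suc n)      -- ⊤s n is ⊤^(n+1)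

module _ (L : MatrixLogic) where
  open MatrixLogic L

  ⊤^ : ∀ n → sig n
  ⊤^ zero = ⊤c
  ⊤^ (suc n) = ⊤s n

  ⊤F ⊥F : Fm sig
  ⊤F = con ⊤c []
  ⊥F = con ⊥c []

  _⊢[_]_ : FmSet sig → RuleSet sig → Fm sig → Set
  Γ ⊢[ R ] φ = Derivable (R ∪R Δ) Γ φ

  _⊢_ : FmSet sig → Fm sig → Set
  Γ ⊢ φ = Γ ⊢[ ∅R ] φ

  Thm : Fm sig → Set
  Thm φ = ∅F ⊢ φ

  _⊨_ : FmSet sig → Fm sig → Set₁
  Γ ⊨ φ = ∀ (M : Matrix sig) → 𝓜 M → (ρ : ℕ → Matrix.Carrier M) →
          (∀ γ → Γ γ → Matrix.D M (eval M ρ γ)) → Matrix.D M (eval M ρ φ)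

  Sound : Set₁
  Sound = ∀ (Γ : FmSet sig) φ → Γ ⊢ φ → Γ ⊨ φ

  record Standing : Set₁ where
    field
      ⊢⊤      : Thm ⊤F
      ⊥⊢      : ∀ φ → singleton ⊥F ⊢ φ
      ⊤-des   : ∀ (M : Matrix sig) → 𝓜 M → Matrix.D M (Matrix.op M ⊤c [])
      ⊥-undes : ∀ (M : Matrix sig) → 𝓜 M → ¬ Matrix.D M (Matrix.op M ⊥c [])
      ⊤^-equiv : ∀ n (φs : Vec (Fm sig) (suc n)) →
                 (singleton (con (⊤s n) φs) ⊢ ⊤F) × (singleton ⊤F ⊢ con (⊤s n) φs)

  Admissible : Rule sig → Set
  Admissible r = ∀ (σ : ℕ → Fm sig) →
    (∀ {a} → a ∈ prem r → Thm (sub σ a)) → Thm (sub σ (concl r))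

  Basis : RuleSet sig → Set
  Basis B = (∀ r → B r → Admissible r) ×
            (∀ r → Admissible r → listSet (prem r) ⊢[ B ] concl r)

  record Equivalence : Set where
    field
      ⇔c : sig 2
    _⇔_ : Fm sig → Fm sig → Fm sig
    φ ⇔ ψ = con ⇔c (φ ∷ ψ ∷ [])
    field
      refl⇔  : ∀ φ → Thm (φ ⇔ φ)
      sym⇔   : ∀ φ ψ → Thm (φ ⇔ ψ) → Thm (ψ ⇔ φ)
      trans⇔ : ∀ φ ψ χ → Thm (φ ⇔ ψ) → Thm (ψ ⇔ χ) → Thm (φ ⇔ χ)
      cong⇔  : ∀ n (c : sig n) (φs ψs : Vec (Fm sig) n) →
               (∀ i → Thm (lookup φs i ⇔ lookup ψs i)) → Thm (con c φs ⇔ con c ψs)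
      mp⇔    : ∀ φ ψ → Thm φ → Thm (φ ⇔ ψ) → Thm ψ

module _ {S : Sig} where

  -- vertices of t(φ): subformula occurrences
  data Pos : Fm S → Set where
    here  : ∀ {φ} → Pos φ
    there : ∀ {n} {c : S n} {as : Vec (Fm S) n} (i : Fin n) →
            Pos (lookup as i) → Pos (con c as)

  subAt : ∀ {φ} → Pos φ → Fm S
  subAt {φ} here = φ
  subAt (there i v) = subAt v

  arity : Fm S → ℕ
  arity (var _) = 0
  arity (con {n} _ _) = n

  outdeg : ∀ {φ} → Pos φ → ℕ
  outdeg v = arity (subAt v)

  child : ∀ {φ} (v : Pos φ) → Fin (outdeg v) → Pos φ
  child {var _} here ()
  child {con c as} here i = there i here
  child (there j v) i = there j (child v i)

  Edge : Fm S → Set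
  Edge φ = Σ[ v ∈ Pos φ ] Fin (outdeg v)

  src : ∀ {φ} → Edge φ → Pos φ
  src e = proj₁ e

  tgt : ∀ {φ} → Edge φ → Pos φ
  tgt (v , i) = child v i

  record TreeEmb (φ ψ : Fm S) : Set where
    field
      fV     : Pos φ → Pos ψ
      fE     : Edge φ → Edge ψ
      fV-inj : Injective _≡_ _≡_ fV
      fE-inj : Injective _≡_ _≡_ fE
      src-pres : ∀ e → src (fE e) ≡ fV (src e)
      tgt-pres : ∀ e → tgt (fE e) ≡ fV (tgt e)
      deg-pres : ∀ e → outdeg (src (fE e)) ≡ outdeg (src e)

  _≈t_ : Fm S → Fm S → Set
  φ ≈t ψ = TreeEmb φ ψ × TreeEmb ψ φ

module _ (L : MatrixLogic) (E : Equivalence L) where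
  open MatrixLogic L
  open Equivalence E

  fill : ∀ {n} → Fin n → (Fin n → sig 0) → Fm sig → Vec (Fm sig) n
  fill k o φ = tabulate (λ i → if does (i ≟F k) then φ else con (o i) [])

  -- c has identities for position k (witnessed by the constants o_i, i ≠ k;
  -- the value o k is irrelevant) and pairwise formula completion for position j
  record IdComp {n} (c : sig n) (k j : Fin n) : Set where
    field
      o        : Fin n → sig 0
      identity : ∀ φ → Thm L (con c (fill k o φ) ⇔ φ)
      complete : ∀ (ψ : Fm sig) → ∃[ δ ] (Thm L (con (o j) [] ⇔ δ) × (δ ≈t ψ))

Complementary : (L : MatrixLogic) → Equivalence L → (L' : MatrixLogic) → Equivalence L' → Set
Complementary L E L' E' =
  Σ[ n ∈ ℕ ] (2 ≤ n) × Σ[ k ∈ Fin n ] Σ[ k' ∈ Fin n ] (k ≢ k') ×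
    (Σ[ c ∈ MatrixLogic.sig L n ] IdComp L E c k k') ×
    (Σ[ c' ∈ MatrixLogic.sig L' n ] IdComp L' E' c' k' k)

Similar : MatrixLogic → MatrixLogic → Set
Similar L L' = ∀ i → (¬ MatrixLogic.sig L i → ¬ MatrixLogic.sig L' i) ×
                     (¬ MatrixLogic.sig L' i → ¬ MatrixLogic.sig L i)

inst : ∀ {S : Sig} → ℕ → ℕ → ∀ {n} → S n → ℕ → Fm S
inst i j {n} c m =
  if m ≡ᵇ i then con c (tabulate (λ x → var (j + suc (toℕ x)))) else var m

maxVarRule : ∀ {S} → Rule S → ℕ
maxVarRule r = foldr _⊔_ (maxVar (concl r)) (map maxVar (prem r))

data Tagged {S : Sig} (r : Rule S) : Rule S → Set where
  nonvar : (∀ i → concl r ≢ var i) → Tagged r r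
  isvar  : ∀ i → concl r ≡ var i → ∀ n (c : S n) →
           Tagged r (substRule (inst i (maxVarRule r) c) r)

tagSet : ∀ {S} → RuleSet S → RuleSet S
tagSet R r' = ∃[ r ] (R r × Tagged r r')

module _ (L₁ L₂ : MatrixLogic) where
  private
    module L₁ = MatrixLogic L₁
    module L₂ = MatrixLogic L₂

  Σ₁₂ : Sig
  Σ₁₂ n = L₁.sig n × L₂.sig n

  emb₁ : Fm L₁.sig → Fm Σ₁₂
  emb₁ = rename (λ {n} c → c , ⊤^ L₂ n)

  emb₂ : Fm L₂.sig → Fm Σ₁₂
  emb₂ = rename (λ {n} c → ⊤^ L₁ n , c)

  ∣_∣₁ : Fm Σ₁₂ → Fm L₁.sig
  ∣_∣₁ = rename proj₁

  ∣_∣₂ : Fm Σ₁₂ → Fm L₂.sig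
  ∣_∣₂ = rename proj₂

  embRule₁ : Rule L₁.sig → Rule Σ₁₂
  embRule₁ r = map emb₁ (prem r) / emb₁ (concl r)

  embRule₂ : Rule L₂.sig → Rule Σ₁₂
  embRule₂ r = map emb₂ (prem r) / emb₂ (concl r)

  embSet₁ : RuleSet L₁.sig → RuleSet Σ₁₂
  embSet₁ R r' = ∃[ r ] (R r × r' ≡ embRule₁ r)

  embSet₂ : RuleSet L₂.sig → RuleSet Σ₁₂
  embSet₂ R r' = ∃[ r ] (R r × r' ≡ embRule₂ r)

  tag₁ : RuleSet L₁.sig → RuleSet Σ₁₂
  tag₁ R = embSet₁ (tagSet R)

  tag₂ : RuleSet L₂.sig → RuleSet Σ₁₂
  tag₂ R = embSet₂ (tagSet R)

  data Δ₁₂ : RuleSet Σ₁₂ where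
    tagged₁ : ∀ {r} → tag₁ L₁.Δ r → Δ₁₂ r
    tagged₂ : ∀ {r} → tag₂ L₂.Δ r → Δ₁₂ r
    lifting : ∀ φ → Δ₁₂ ((emb₁ ∣ φ ∣₁ ∷ emb₂ ∣ φ ∣₂ ∷ []) / φ)
    colift₁ : ∀ φ → Δ₁₂ ((φ ∷ []) / emb₁ ∣ φ ∣₁)
    colift₂ : ∀ φ → Δ₁₂ ((φ ∷ []) / emb₂ ∣ φ ∣₂)
    bot₁₂   : Δ₁₂ ((emb₁ (⊥F L₁) ∷ []) / emb₂ (⊥F L₂))
    bot₂₁   : Δ₁₂ ((emb₂ (⊥F L₂) ∷ []) / emb₁ (⊥F L₁))

  prodMatrix : Matrix L₁.sig → Matrix L₂.sig → Matrix Σ₁₂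
  prodMatrix M₁ M₂ = record
    { Carrier = M₁.Carrier × M₂.Carrier
    ; op = λ { (c₁ , c₂) as → M₁.op c₁ (Data.Vec.map proj₁ as) , M₂.op c₂ (Data.Vec.map proj₂ as) }
    ; D = λ { (x , y) → M₁.D x × M₂.D y }
    ; D-nonempty = (proj₁ M₁.D-nonempty , proj₁ M₂.D-nonempty) ,
                   (proj₂ M₁.D-nonempty , proj₂ M₂.D-nonempty)
    }
    where
      module M₁ = Matrix M₁
      module M₂ = Matrix M₂

  𝓜₁₂ : Matrix Σ₁₂ → Set₁
  𝓜₁₂ M = ∃[ M₁ ] ∃[ M₂ ] (L₁.𝓜 M₁ × L₂.𝓜 M₂ × M ≡ prodMatrix M₁ M₂)

  meet : MatrixLogic
  meet = record
    { sig = Σ₁₂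
    ; Δ = Δ₁₂
    ; 𝓜 = 𝓜₁₂
    ; 𝓜-nonempty =
        let (M₁ , m₁) = L₁.𝓜-nonempty ; (M₂ , m₂) = L₂.𝓜-nonempty
        in prodMatrix M₁ M₂ , M₁ , M₂ , m₁ , m₂ , _≡_.refl
    ; ⊤c = L₁.⊤c , L₂.⊤c
    ; ⊥c = L₁.⊥c , L₂.⊥c
    ; ⊤s = λ n → L₁.⊤s n , L₂.⊤s n
    }

module Submission where

-- The theorems of L₁L₂ are exactly the formulas both of whose projections are
-- theorems: every rule of L₁L₂ preserves this property (the ⊥-rules vacuously, as ⊥
-- is not a theorem of a sound logic), and conversely lifting reassembles a formula
-- from its embedded projections. Embedding the theorems of L_k needs the tags: a
-- sound logic has no variable theorems, so every application of a Δ_k-rule with a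
-- variable conclusion is an instance of one of its tagged rules. Hence a tagged
-- B₁-rule is admissible in L₁L₂: on first projections it is an instance of an
-- admissible rule of L₁, and on second projections its conclusion is a ⊤ⁿ-formula.
-- Rules derived from admissible rules are admissible.

open import Defs
open import Data.List using (List)

open import Data.Nat using (ℕ; zero; suc; _+_; _∸_; _≤_; _≡ᵇ_; _≤?_)
open import Data.Nat.Properties using (≡ᵇ⇒≡; ≡⇒≡ᵇ; +-suc; m+1+n≰m; m+n∸m≡n; m≤m⊔n; m≤n⇒m≤o⊔n; m⊔n≤o⇒m≤o; m⊔n≤o⇒n≤o; ≤-refl)
open import Data.Fin using (Fin; toℕ)
import Data.Fin as Fin
open import Data.Vec using (Vec; []; _∷_; lookup; tabulate)
open import Data.Vec.Properties using (tabulate-cong; tabulate∘lookup)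
open import Data.List using ([]; _∷_; map; _++_)
open import Data.List.Properties using (map-∘; map-cong-local)
open import Data.List.Relation.Unary.All as All using (All; []; _∷_)
open import Data.List.Relation.Unary.Any using (here; there)
open import Data.List.Membership.Propositional using (_∈_)
open import Data.List.Membership.Propositional.Properties using (∈-map⁺; ∈-map⁻; ∈-++⁺ˡ; ∈-++⁺ʳ)
open import Data.Product using (∃-syntax; _×_; _,_; proj₁; proj₂)
open import Data.Sum using (inj₁; inj₂)
open import Data.Empty using (⊥-elim)
open import Data.Bool using (true; false; T)
open import Function using (_∘_)
open import Relation.Nullary using (¬_; yes; no)
open import Relation.Binary.PropositionalEquality using (_≡_; refl; sym; trans; cong; cong₂; subst; module ≡-Reasoning)

module _ {S : Sig} where

  mutual
    sub-∘ : (σ τ : ℕ → Fm S) (φ : Fm S) → sub σ (sub τ φ) ≡ sub (sub σ ∘ τ) φ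
    sub-∘ σ τ (var i) = refl
    sub-∘ σ τ (con c as) = cong (con c) (subs-∘ σ τ as)

    subs-∘ : ∀ {n} (σ τ : ℕ → Fm S) (as : Vec (Fm S) n) → subs σ (subs τ as) ≡ subs (sub σ ∘ τ) as
    subs-∘ σ τ [] = refl
    subs-∘ σ τ (a ∷ as) = cong₂ _∷_ (sub-∘ σ τ a) (subs-∘ σ τ as)

  mutual
    sub-var : (φ : Fm S) → sub var φ ≡ φ
    sub-var (var i) = refl
    sub-var (con c as) = cong (con c) (subs-var as)

    subs-var : ∀ {n} (as : Vec (Fm S) n) → subs var as ≡ as
    subs-var [] = refl
    subs-var (a ∷ as) = cong₂ _∷_ (sub-var a) (subs-var as)

  mutual
    sub-cong-≤maxVar : ∀ {σ τ : ℕ → Fm S} {j} → (∀ m → m ≤ j → σ m ≡ τ m) →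
                       ∀ φ → maxVar φ ≤ j → sub σ φ ≡ sub τ φ
    sub-cong-≤maxVar σ≡τ (var i) i≤j = σ≡τ i i≤j
    sub-cong-≤maxVar σ≡τ (con c as) as≤j = cong (con c) (subs-cong-≤maxVar σ≡τ as as≤j)

    subs-cong-≤maxVar : ∀ {σ τ : ℕ → Fm S} {j} → (∀ m → m ≤ j → σ m ≡ τ m) →
                        ∀ {n} (as : Vec (Fm S) n) → maxVars as ≤ j → subs σ as ≡ subs τ as
    subs-cong-≤maxVar σ≡τ [] _ = refl
    subs-cong-≤maxVar σ≡τ (a ∷ as) ≤j =
      cong₂ _∷_ (sub-cong-≤maxVar σ≡τ a (m⊔n≤o⇒m≤o _ _ ≤j))
                (subs-cong-≤maxVar σ≡τ as (m⊔n≤o⇒n≤o _ _ ≤j))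

  subs-tabulate-var : (σ : ℕ → Fm S) {n : ℕ} (g : Fin n → ℕ) →
                      subs σ (tabulate (var ∘ g)) ≡ tabulate (σ ∘ g)
  subs-tabulate-var σ {zero} g = refl
  subs-tabulate-var σ {suc n} g = cong (σ (g Fin.zero) ∷_) (subs-tabulate-var σ (g ∘ Fin.suc))

module _ {S S' : Sig} (f : ∀ {n} → S n → S' n) where

  mutual
    rename-sub : (σ : ℕ → Fm S) (φ : Fm S) → rename f (sub σ φ) ≡ sub (rename f ∘ σ) (rename f φ)
    rename-sub σ (var i) = refl
    rename-sub σ (con c as) = cong (con (f c)) (renames-sub σ as)

    renames-sub : ∀ {n} (σ : ℕ → Fm S) (as : Vec (Fm S) n) →
                  renames f (subs σ as) ≡ subs (rename f ∘ σ) (renames f as)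
    renames-sub σ [] = refl
    renames-sub σ (a ∷ as) = cong₂ _∷_ (rename-sub σ a) (renames-sub σ as)

  renameRule : Rule S → Rule S'
  renameRule r = map (rename f) (prem r) / rename f (concl r)

module _ {S S' : Sig} (f : ∀ {n} → S n → S' n) (g : ∀ {n} → S' n → S n)
       (g∘f≡id : ∀ {n} (c : S n) → g (f c) ≡ c) where

  mutual
    rename-inverse : (φ : Fm S) → rename g (rename f φ) ≡ φ
    rename-inverse (var i) = refl
    rename-inverse (con c as) = cong₂ con (g∘f≡id c) (renames-inverse as)

    renames-inverse : ∀ {n} (as : Vec (Fm S) n) → renames g (renames f as) ≡ as
    renames-inverse [] = refl
    renames-inverse (a ∷ as) = cong₂ _∷_ (rename-inverse a) (renames-inverse as)

  rename-sub-rename : (σ : ℕ → Fm S') (φ : Fm S) →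
                      rename g (sub σ (rename f φ)) ≡ sub (rename g ∘ σ) φ
  rename-sub-rename σ φ =
    trans (rename-sub g σ (rename f φ)) (cong (sub (rename g ∘ σ)) (rename-inverse φ))

AdmissibleFor : ∀ {S} → (Fm S → Set) → Rule S → Set
AdmissibleFor T r = ∀ σ → (∀ {a} → a ∈ prem r → T (sub σ a)) → T (sub σ (concl r))

∈-map-elim : ∀ {A B : Set} {P : B → Set} (f : A → B) {xs : List A} →
             (∀ {a} → a ∈ xs → P (f a)) → ∀ {b} → b ∈ map f xs → P b
∈-map-elim f h m with ∈-map⁻ f m
... | (a , a∈ , refl) = h a∈

module _ {S : Sig} where

  AdmissibleFor-sub : ∀ {T : Fm S → Set} {r} σ → AdmissibleFor T r → AdmissibleFor (T ∘ sub σ) r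
  AdmissibleFor-sub {T} {r} σ adm τ h =
    subst T (sym (sub-∘ σ τ (concl r))) (adm (sub σ ∘ τ) λ {a} a∈ → subst T (sub-∘ σ τ a) (h a∈))

  AdmissibleFor-substRule : ∀ {T : Fm S → Set} {r} θ → AdmissibleFor T r → AdmissibleFor T (substRule θ r)
  AdmissibleFor-substRule {T} {r} θ adm σ h =
    subst T (sym (sub-∘ σ θ (concl r)))
      (adm (sub σ ∘ θ) λ {a} a∈ → subst T (sub-∘ σ θ a) (h (∈-map⁺ (sub θ) a∈)))

  AdmissibleFor-instance : ∀ {T : Fm S → Set} {r ρ} τ → AdmissibleFor T r → substRule τ r ≡ ρ →
                           (∀ {q} → q ∈ prem ρ → T q) → T (concl ρ)
  AdmissibleFor-instance τ adm refl h = adm τ (h ∘ ∈-map⁺ _)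

  AdmissibleFor-renameRule : ∀ {S'} {f : ∀ {n} → S n → S' n} {T : Fm S' → Set} {r} →
                             AdmissibleFor T (renameRule f r) → AdmissibleFor (T ∘ rename f) r
  AdmissibleFor-renameRule {f = f} {T} {r} adm σ h =
    subst T (sym (rename-sub f σ (concl r)))
      (adm (rename f ∘ σ) (∈-map-elim (rename f) λ {a} a∈ → subst T (rename-sub f σ a) (h a∈)))

module _ {S S' : Sig} (f : ∀ {n} → S n → S' n) (g : ∀ {n} → S' n → S n)
         (g∘f≡id : ∀ {n} (c : S n) → g (f c) ≡ c) where

  AdmissibleFor-retract : ∀ {T : Fm S → Set} {r} → AdmissibleFor T r →
                          AdmissibleFor (T ∘ rename g) (renameRule f r)
  AdmissibleFor-retract {T} {r} adm σ h =
    subst T (sym (rename-sub-rename f g g∘f≡id σ (concl r)))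
      (adm (rename g ∘ σ) λ {a} a∈ → subst T (rename-sub-rename f g g∘f≡id σ a) (h (∈-map⁺ (rename f) a∈)))

module _ {S : Sig} {R : RuleSet S} {Γ : FmSet S} where

  private
    Deriv-++ : ∀ {ψs χs} → Deriv R Γ ψs → Deriv R Γ χs → Deriv R Γ (χs ++ ψs)
    Deriv-++ d empty = d
    Deriv-++ d (hyp e γ) = hyp (Deriv-++ d e) γ
    Deriv-++ d (rule r Rr σ mem e) = rule r Rr σ (∈-++⁺ˡ ∘ mem) (Deriv-++ d e)

    Deriv-all : (ps : List (Fm S)) → (∀ {p} → p ∈ ps → Derivable R Γ p) →
                ∃[ ψs ] (Deriv R Γ ψs × (∀ {p} → p ∈ ps → p ∈ ψs))
    Deriv-all [] h = [] , empty , λ ()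
    Deriv-all (p ∷ ps) h with h (here refl) | Deriv-all ps (h ∘ there)
    ... | (χs , d) | (ψs , e , ps⊆ψs) =
      (p ∷ χs) ++ ψs , Deriv-++ e d ,
      λ { (here refl) → here refl ; (there m) → ∈-++⁺ʳ (p ∷ χs) (ps⊆ψs m) }

    Deriv-ind : (Q : Fm S → Set) → (∀ γ → Γ γ → Q γ) → (∀ r → R r → AdmissibleFor Q r) →
                ∀ {ψs} → Deriv R Γ ψs → ∀ {φ} → φ ∈ ψs → Q φ
    Deriv-ind Q hΓ hR (hyp d γ) (here refl) = hΓ _ γ
    Deriv-ind Q hΓ hR (hyp d γ) (there m) = Deriv-ind Q hΓ hR d m
    Deriv-ind Q hΓ hR (rule r Rr σ mem d) (here refl) = hR r Rr σ (Deriv-ind Q hΓ hR d ∘ mem)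
    Deriv-ind Q hΓ hR (rule r Rr σ mem d) (there m) = Deriv-ind Q hΓ hR d m

  Derivable-rule : ∀ {r} → R r → AdmissibleFor (Derivable R Γ) r
  Derivable-rule {r} Rr σ h with Deriv-all (map (sub σ) (prem r)) (∈-map-elim (sub σ) h)
  ... | (ψs , d , prems⊆ψs) = ψs , rule r Rr σ (prems⊆ψs ∘ ∈-map⁺ (sub σ)) d

  Derivable-ind : (Q : Fm S → Set) → (∀ γ → Γ γ → Q γ) → (∀ r → R r → AdmissibleFor Q r) →
                  ∀ {φ} → Derivable R Γ φ → Q φ
  Derivable-ind Q hΓ hR (_ , d) = Deriv-ind Q hΓ hR d (here refl)

Derivable⇒AdmissibleFor : ∀ {S} {R : RuleSet S} (T : Fm S → Set) {αs β} →
                          (∀ r → R r → AdmissibleFor T r) →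
                          Derivable R (listSet αs) β → AdmissibleFor T (αs / β)
Derivable⇒AdmissibleFor T adm d σ hα =
  Derivable-ind (T ∘ sub σ) (λ _ → hα) (λ r Rr → AdmissibleFor-sub {T = T} {r} σ (adm r Rr)) d

data IsCon {S : Sig} : Fm S → Set where
  isCon : ∀ {n} (c : S n) (as : Vec (Fm S) n) → IsCon (con c as)

module _ {S : Sig} where

  maxVar-concl≤maxVarRule : (r : Rule S) → maxVar (concl r) ≤ maxVarRule r
  maxVar-concl≤maxVarRule ([] / φ) = ≤-refl
  maxVar-concl≤maxVarRule ((p ∷ ps) / φ) = m≤n⇒m≤o⊔n (maxVar p) (maxVar-concl≤maxVarRule (ps / φ))

  maxVar-prem≤maxVarRule : (r : Rule S) → All (λ p → maxVar p ≤ maxVarRule r) (prem r)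
  maxVar-prem≤maxVarRule ([] / φ) = []
  maxVar-prem≤maxVarRule ((p ∷ ps) / φ) =
    m≤m⊔n _ _ ∷ All.map (m≤n⇒m≤o⊔n (maxVar p)) (maxVar-prem≤maxVarRule (ps / φ))

  Tagged-IsCon : ∀ {r r' : Rule S} → Tagged r r' → IsCon (concl r')
  Tagged-IsCon {ps / var i} (nonvar concl≢var) = ⊥-elim (concl≢var i refl)
  Tagged-IsCon {ps / con c as} (nonvar _) = isCon c as
  Tagged-IsCon {_ / _} (isvar i refl _ c) with i ≡ᵇ i | ≡⇒≡ᵇ i i refl
  ... | true | _ = isCon c _

  Tagged-admissible : ∀ {T : Fm S → Set} {r r' : Rule S} → Tagged r r' → AdmissibleFor T r → AdmissibleFor T r'
  Tagged-admissible (nonvar _) adm = adm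
  Tagged-admissible {T} {r} (isvar _ _ _ _) adm = AdmissibleFor-substRule {T = T} {r} _ adm

  private
    lookupℕ : ∀ {n} → Vec (Fm S) n → ℕ → Fm S
    lookupℕ [] _ = var 0
    lookupℕ (a ∷ as) zero = a
    lookupℕ (a ∷ as) (suc k) = lookupℕ as k

    lookupℕ-toℕ : ∀ {n} (as : Vec (Fm S) n) (x : Fin n) → lookupℕ as (toℕ x) ≡ lookup as x
    lookupℕ-toℕ (a ∷ as) Fin.zero = refl
    lookupℕ-toℕ (a ∷ as) (Fin.suc x) = lookupℕ-toℕ as x

  extendAbove : ℕ → (ℕ → Fm S) → ∀ {n} → Vec (Fm S) n → ℕ → Fm S
  extendAbove j σ as m with m ≤? j
  ... | yes _ = σ m
  ... | no _ = lookupℕ as (m ∸ suc j)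

  extendAbove-≤ : ∀ {j σ n} (as : Vec (Fm S) n) {m} → m ≤ j → extendAbove j σ as m ≡ σ m
  extendAbove-≤ {j} as {m} m≤j with m ≤? j
  ... | yes _ = refl
  ... | no m≰j = ⊥-elim (m≰j m≤j)

  extendAbove-> : ∀ {j σ n} (as : Vec (Fm S) n) (x : Fin n) → extendAbove j σ as (j + suc (toℕ x)) ≡ lookup as x
  extendAbove-> {j} as x with j + suc (toℕ x) ≤? j
  ... | yes j+1+x≤j = ⊥-elim (m+1+n≰m j j+1+x≤j)
  ... | no _ = trans (cong (lookupℕ as) (trans (cong (_∸ suc j) (+-suc j (toℕ x))) (m+n∸m≡n j (toℕ x))))
                     (lookupℕ-toℕ as x)

  inst-extendAbove : ∀ {σ i j n} {c : S n} {as} → σ i ≡ con c as →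
                     ∀ m → m ≤ j → sub (extendAbove j σ as) (inst i j c m) ≡ σ m
  inst-extendAbove {σ} {i} {j} {c = c} {as} σi≡c[as] m m≤j with m ≡ᵇ i in m≡ᵇi
  ... | false = extendAbove-≤ as m≤j
  ... | true = begin
    con c (subs τ (tabulate (λ x → var (j + suc (toℕ x)))))  ≡⟨ cong (con c) (subs-tabulate-var τ _) ⟩
    con c (tabulate (λ x → τ (j + suc (toℕ x))))            ≡⟨ cong (con c) (tabulate-cong (extendAbove-> {j} {σ} as)) ⟩
    con c (tabulate (lookup as))                            ≡⟨ cong (con c) (tabulate∘lookup as) ⟩
    con c as                                                ≡⟨ sym σi≡c[as] ⟩
    σ i                                                     ≡⟨ cong σ (sym (≡ᵇ⇒≡ m i (subst T (sym m≡ᵇi) _))) ⟩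
    σ m                                                     ∎
    where
    open ≡-Reasoning
    τ = extendAbove j σ as

  Tagged-instance : (r : Rule S) (σ : ℕ → Fm S) → IsCon (sub σ (concl r)) →
                    ∃[ r' ] Tagged r r' × ∃[ τ ] substRule τ r' ≡ substRule σ r
  Tagged-instance (ps / con c as) σ _ = _ , nonvar (λ _ ()) , σ , refl
  Tagged-instance (ps / var i) σ σi-con with σ i in σi≡c[as] | σi-con
  ... | con c as | _ =
    _ , isvar i refl _ c , extendAbove j σ as ,
    cong₂ _/_ (trans (sym (map-∘ ps)) (map-cong-local (All.map (λ {p} → agree-prem {p}) (maxVar-prem≤maxVarRule r))))
              (trans (agree i (maxVar-concl≤maxVarRule r)) σi≡c[as])
    where
    r = ps / var i
    j = maxVarRule r
    θ = inst i j c
    agree : ∀ m → m ≤ j → sub (extendAbove j σ as) (θ m) ≡ σ m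
    agree = inst-extendAbove σi≡c[as]
    agree-prem : ∀ {p} → maxVar p ≤ j → sub (extendAbove j σ as) (sub θ p) ≡ sub σ p
    agree-prem {p} p≤j = trans (sub-∘ _ θ p) (sub-cong-≤maxVar agree p p≤j)

module _ (L : MatrixLogic) where
  open MatrixLogic L

  Thm-closed : ∀ {r} → Δ r → AdmissibleFor (Thm L) r
  Thm-closed Δr = Derivable-rule (inj₂ Δr)

  Thm-cut : ∀ {Γ ψ} → (∀ γ → Γ γ → Thm L γ) → _⊢_ L Γ ψ → Thm L ψ
  Thm-cut ⊢Γ = Derivable-ind (Thm L) ⊢Γ (λ _ → Derivable-rule)

module _ {L : MatrixLogic} (st : Standing L) where
  open MatrixLogic L
  open Standing st

  Thm-⊤^ : ∀ n (φs : Vec (Fm sig) n) → Thm L (con (⊤^ L n) φs)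
  Thm-⊤^ zero [] = ⊢⊤
  Thm-⊤^ (suc n) φs = Thm-cut L (λ { _ refl → ⊢⊤ }) (proj₂ (⊤^-equiv n φs))

  module _ (sound : Sound L) where
    private
      M = proj₁ 𝓜-nonempty
      ⊥ᴹ = Matrix.op M ⊥c []

      Thm-holds-at-⊥ : ∀ {φ} → Thm L φ → Matrix.D M (eval M (λ _ → ⊥ᴹ) φ)
      Thm-holds-at-⊥ {φ} ⊢φ = sound ∅F φ ⊢φ M (proj₂ 𝓜-nonempty) (λ _ → ⊥ᴹ) (λ _ ())

    ¬Thm-var : ∀ m → ¬ Thm L (var m)
    ¬Thm-var m = ⊥-undes M (proj₂ 𝓜-nonempty) ∘ Thm-holds-at-⊥

    ¬Thm-⊥ : ¬ Thm L (⊥F L)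
    ¬Thm-⊥ = ⊥-undes M (proj₂ 𝓜-nonempty) ∘ Thm-holds-at-⊥

    Thm-IsCon : ∀ {φ} → Thm L φ → IsCon φ
    Thm-IsCon {var m} ⊢m = ⊥-elim (¬Thm-var m ⊢m)
    Thm-IsCon {con c as} _ = isCon c as

-- A Δ-rule with variable conclusion ξ_i is only applied at σ with σ ξ_i = c(as),
-- which is an instance of its tagged version for c.
module _ (L : MatrixLogic) {S' : Sig} (f : ∀ {n} → MatrixLogic.sig L n → S' n) (T : Fm S' → Set)
         (Thm-IsCon : ∀ {φ} → Thm L φ → IsCon φ)
         (tagged-admissible : ∀ {r} → tagSet (MatrixLogic.Δ L) r → AdmissibleFor T (renameRule f r)) where
  open MatrixLogic L

  Thm-rename : ∀ {φ} → Thm L φ → T (rename f φ)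
  Thm-rename = proj₂ ∘ Derivable-ind (λ φ → Thm L φ × T (rename f φ)) (λ _ ()) step
    where
    step : ∀ r → (∅R ∪R Δ) r → AdmissibleFor (λ φ → Thm L φ × T (rename f φ)) r
    step r (inj₂ Δr) σ h = ⊢concl , T-concl (Tagged-instance r σ (Thm-IsCon ⊢concl))
      where
      ⊢concl : Thm L (sub σ (concl r))
      ⊢concl = Thm-closed L Δr σ (proj₁ ∘ h)
      T-concl : ∃[ r' ] Tagged r r' × ∃[ τ ] substRule τ r' ≡ substRule σ r → T (rename f (sub σ (concl r)))
      T-concl (r' , tagged , τ , τr'≡σr) =
        AdmissibleFor-instance {T = T ∘ rename f} {r'} τ
          (AdmissibleFor-renameRule {T = T} {r'} (tagged-admissible (r , Δr , tagged))) τr'≡σr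
          (∈-map-elim (sub σ) (proj₂ ∘ h))

module MeetTheorems {L₁ L₂ : MatrixLogic} (st₁ : Standing L₁) (st₂ : Standing L₂)
                    (sound₁ : Sound L₁) (sound₂ : Sound L₂) where
  private
    module L₁ = MatrixLogic L₁
    module L₂ = MatrixLogic L₂

    S₁₂ : Sig
    S₁₂ = Σ₁₂ L₁ L₂

    Thm₁₂ : Fm S₁₂ → Set
    Thm₁₂ = Thm (meet L₁ L₂)

    π₁ : Fm S₁₂ → Fm L₁.sig
    π₁ = ∣_∣₁ L₁ L₂

    π₂ : Fm S₁₂ → Fm L₂.sig
    π₂ = ∣_∣₂ L₁ L₂

    ι₁ : Fm L₁.sig → Fm S₁₂
    ι₁ = emb₁ L₁ L₂

    ι₂ : Fm L₂.sig → Fm S₁₂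
    ι₂ = emb₂ L₁ L₂

    ι₁-con : ∀ {n} → L₁.sig n → S₁₂ n
    ι₁-con {n} c = c , ⊤^ L₂ n

    ι₂-con : ∀ {n} → L₂.sig n → S₁₂ n
    ι₂-con {n} c = ⊤^ L₁ n , c

  Componentwise : Fm S₁₂ → Set
  Componentwise φ = Thm L₁ (π₁ φ) × Thm L₂ (π₂ φ)

  π₁-sub-ι₁ : ∀ σ ψ → π₁ (sub σ (ι₁ ψ)) ≡ sub (π₁ ∘ σ) ψ
  π₁-sub-ι₁ = rename-sub-rename ι₁-con proj₁ (λ _ → refl)

  π₂-sub-ι₂ : ∀ σ ψ → π₂ (sub σ (ι₂ ψ)) ≡ sub (π₂ ∘ σ) ψ
  π₂-sub-ι₂ = rename-sub-rename ι₂-con proj₂ (λ _ → refl)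

  π₁-sub-ι₁π₁ : ∀ σ φ → π₁ (sub σ (ι₁ (π₁ φ))) ≡ π₁ (sub σ φ)
  π₁-sub-ι₁π₁ σ φ = trans (π₁-sub-ι₁ σ (π₁ φ)) (sym (rename-sub proj₁ σ φ))

  π₂-sub-ι₂π₂ : ∀ σ φ → π₂ (sub σ (ι₂ (π₂ φ))) ≡ π₂ (sub σ φ)
  π₂-sub-ι₂π₂ σ φ = trans (π₂-sub-ι₂ σ (π₂ φ)) (sym (rename-sub proj₂ σ φ))

  -- the other projection of an embedded non-variable formula is a ⊤ⁿ-formula
  Thm-π₂-sub-ι₁ : ∀ {ψ} → IsCon ψ → ∀ σ → Thm L₂ (π₂ (sub σ (ι₁ ψ)))
  Thm-π₂-sub-ι₁ (isCon {n} _ _) _ = Thm-⊤^ st₂ n _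

  Thm-π₁-sub-ι₂ : ∀ {ψ} → IsCon ψ → ∀ σ → Thm L₁ (π₁ (sub σ (ι₂ ψ)))
  Thm-π₁-sub-ι₂ (isCon {n} _ _) _ = Thm-⊤^ st₁ n _

  tag₁-Componentwise : ∀ {R} → (∀ r → R r → AdmissibleFor (Thm L₁) r) →
                       ∀ r → tag₁ L₁ L₂ R r → AdmissibleFor Componentwise r
  tag₁-Componentwise adm _ (r , (r₀ , Rr₀ , tagged) , refl) σ h =
    AdmissibleFor-retract ι₁-con proj₁ (λ _ → refl) {Thm L₁} {r}
      (Tagged-admissible {T = Thm L₁} tagged (adm r₀ Rr₀)) σ (proj₁ ∘ h) ,
    Thm-π₂-sub-ι₁ (Tagged-IsCon tagged) σ

  tag₂-Componentwise : ∀ {R} → (∀ r → R r → AdmissibleFor (Thm L₂) r) →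
                       ∀ r → tag₂ L₁ L₂ R r → AdmissibleFor Componentwise r
  tag₂-Componentwise adm _ (r , (r₀ , Rr₀ , tagged) , refl) σ h =
    Thm-π₁-sub-ι₂ (Tagged-IsCon tagged) σ ,
    AdmissibleFor-retract ι₂-con proj₂ (λ _ → refl) {Thm L₂} {r}
      (Tagged-admissible {T = Thm L₂} tagged (adm r₀ Rr₀)) σ (proj₂ ∘ h)

  Thm₁₂⇒Componentwise : ∀ {φ} → Thm₁₂ φ → Componentwise φ
  Thm₁₂⇒Componentwise = Derivable-ind Componentwise (λ _ ()) step
    where
    step : ∀ r → (∅R ∪R Δ₁₂ L₁ L₂) r → AdmissibleFor Componentwise r
    step r (inj₂ (tagged₁ t)) = tag₁-Componentwise (λ _ → Thm-closed L₁) r t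
    step r (inj₂ (tagged₂ t)) = tag₂-Componentwise (λ _ → Thm-closed L₂) r t
    step _ (inj₂ (lifting φ)) σ h =
      subst (Thm L₁) (π₁-sub-ι₁π₁ σ φ) (proj₁ (h (here refl))) ,
      subst (Thm L₂) (π₂-sub-ι₂π₂ σ φ) (proj₂ (h (there (here refl))))
    step _ (inj₂ (colift₁ (var _))) σ h = h (here refl)
    step _ (inj₂ (colift₁ φ@(con (c₁ , _) _))) σ h =
      subst (Thm L₁) (sym (π₁-sub-ι₁π₁ σ φ)) (proj₁ (h (here refl))) ,
      Thm-π₂-sub-ι₁ (isCon c₁ _) σ
    step _ (inj₂ (colift₂ (var _))) σ h = h (here refl)
    step _ (inj₂ (colift₂ φ@(con (_ , c₂) _))) σ h =
      Thm-π₁-sub-ι₂ (isCon c₂ _) σ ,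
      subst (Thm L₂) (sym (π₂-sub-ι₂π₂ σ φ)) (proj₂ (h (here refl)))
    step _ (inj₂ bot₁₂) σ h = ⊥-elim (¬Thm-⊥ st₁ sound₁ (proj₁ (h (here refl))))
    step _ (inj₂ bot₂₁) σ h = ⊥-elim (¬Thm-⊥ st₂ sound₂ (proj₂ (h (here refl))))

  Thm-ι₁ : ∀ {ψ} → Thm L₁ ψ → Thm₁₂ (ι₁ ψ)
  Thm-ι₁ = Thm-rename L₁ ι₁-con Thm₁₂ (Thm-IsCon st₁ sound₁)
             (λ t → Derivable-rule (inj₂ (tagged₁ (_ , t , refl))))

  Thm-ι₂ : ∀ {ψ} → Thm L₂ ψ → Thm₁₂ (ι₂ ψ)
  Thm-ι₂ = Thm-rename L₂ ι₂-con Thm₁₂ (Thm-IsCon st₂ sound₂)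
             (λ t → Derivable-rule (inj₂ (tagged₂ (_ , t , refl))))

  Componentwise⇒Thm₁₂ : ∀ {φ} → Componentwise φ → Thm₁₂ φ
  Componentwise⇒Thm₁₂ {φ} (⊢π₁φ , ⊢π₂φ) =
    subst Thm₁₂ (sub-var φ)
      (Derivable-rule (inj₂ (lifting φ)) var λ
        { (here refl) → subst Thm₁₂ (sym (sub-var _)) (Thm-ι₁ ⊢π₁φ)
        ; (there (here refl)) → subst Thm₁₂ (sym (sub-var _)) (Thm-ι₂ ⊢π₂φ) })

  Componentwise⇒Thm₁₂-admissible : ∀ {r} → AdmissibleFor Componentwise r → AdmissibleFor Thm₁₂ r
  Componentwise⇒Thm₁₂-admissible adm σ h = Componentwise⇒Thm₁₂ (adm σ (Thm₁₂⇒Componentwise ∘ h))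

proposition4p2 : (L₁ L₂ : MatrixLogic) →
    Standing L₁ → Standing L₂ →
    Sound L₁ → Sound L₂ →
    (E₁ : Equivalence L₁) (E₂ : Equivalence L₂) →
    Similar L₁ L₂ →
    Complementary L₁ E₁ L₂ E₂ →
    (B₁ : RuleSet (MatrixLogic.sig L₁)) (B₂ : RuleSet (MatrixLogic.sig L₂)) →
    Basis L₁ B₁ → Basis L₂ B₂ →
    (αs : List (Fm (Σ₁₂ L₁ L₂))) (β : Fm (Σ₁₂ L₁ L₂)) →
    _⊢[_]_ (meet L₁ L₂) (listSet αs) (tag₁ L₁ L₂ B₁ ∪R tag₂ L₁ L₂ B₂) β →
    Admissible (meet L₁ L₂) (αs / β)
proposition4p2 L₁ L₂ st₁ st₂ sound₁ sound₂ _ _ _ _ B₁ B₂ basis₁ basis₂ αs β =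
  Derivable⇒AdmissibleFor (Thm (meet L₁ L₂)) admissible
  where
  open MeetTheorems st₁ st₂ sound₁ sound₂
  admissible : ∀ r → ((tag₁ L₁ L₂ B₁ ∪R tag₂ L₁ L₂ B₂) ∪R Δ₁₂ L₁ L₂) r → AdmissibleFor (Thm (meet L₁ L₂)) r
  admissible r (inj₁ (inj₁ t)) = Componentwise⇒Thm₁₂-admissible {r} (tag₁-Componentwise (proj₁ basis₁) r t)
  admissible r (inj₁ (inj₂ t)) = Componentwise⇒Thm₁₂-admissible {r} (tag₂-Componentwise (proj₁ basis₂) r t)
  admissible r (inj₂ Δr) = Thm-closed (meet L₁ L₂) Δr
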